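{- Let $M$ be a thread-register model with action set $\mathit{Act}$ and thread map $\mathit{thr}$. Then $\smile_T=\{(a,b)\in\mathit{Act}\times\mathit{Act}:\mathit{thr}(a)\neq\mathit{thr}(b)\}$ is a concurrency relation for $M$.
   Context: An LTS is a tuple $(S,\mathit{Act},\mathit{init},\mathit{Trans})$ with finite $S$, finite $\mathit{Act}$, $\mathit{init}\in S$ and $\mathit{Trans}\subseteq S\times\mathit{Act}\times S$; $a$ is enabled in $s$ if $(s,a,s')\in\mathit{Trans}$ for some $s'$. A path is a nonempty finite or infinite alternating sequence $s_0a_1s_1\ldots$ with $(s_i,a_{i+1},s_{i+1})\in\mathit{Trans}$. A relation $\smile\subseteq\mathit{Act}\times\mathit{Act}$ is a concurrency relation if it is irreflexive and, for every action $a$ and every path from a state $s$ to a state $s'$ such that $a$ is enabled in $s$ and $a\smile b$ for every action $b$ occurring on the path, $a$ is enabled in $s'$. The parallel composition $P_1\|\cdots\|P_k$ of LTSs $P_i=(S_i,\mathit{Act}_i,\mathit{init}_i,\mathit{Trans}_i)$ has states $S_1\times\cdots\times S_k$, actions $\bigcup_i\mathit{Act}_i$, initial state $(\mathit{init}_1,\ldots,\mathit{init}_k)$, and a transition $((s_i)_i,a,(s'_i)_i)$ iff for every $i$: $s'_i=s_i$ if $a\notin\mathit{Act}_i$, and $(s_i,a,s'_i)\in\mathit{Trans}_i$ if $a\in\mathit{Act}_i$. Registers. Fix disjoint finite sets $\mathbb T$ (thread ids) and $\mathbb R$ (register ids); each $r\in\mathbb R$ has a finite domain $D_r$ and initial value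 $d^0_r$. For $t\in\mathbb T$, $r\in\mathbb R$, $d\in D_r$ the register actions are $\mathit{sr}_{t,r}$, $\mathit{fr}_{t,r}(d)$, $\mathit{sw}_{t,r}(d)$, $\mathit{fw}_{t,r}$ (interface) and $\mathit{or}_{t,r}$, $\mathit{ow}_{t,r}$ (register-local). States of a register LTS for $r$ are statuses $s$ with components $\mathit{stor}(s)\in D_r$, $\mathit{rds}(s),\mathit{wrts}(s),\mathit{pend}(s)\subseteq\mathbb T$, and per $t$: $\mathit{rec}(s,t)\in D_r$, $\mathit{ovrl}(s,t)\in\{\mathit{true},\mathit{false}\}$, $\mathit{posv}(s,t)\subseteq D_r$; initially $\mathit{stor}=d^0_r$, $\mathit{rds}=\mathit{wrts}=\mathit{pend}=\emptyset$, $\mathit{rec}(t)=d^0_r$, $\mathit{ovrl}(t)=\mathit{false}$, $\mathit{posv}(t)=\emptyset$. Updates (unmentioned components unchanged, right sides evaluated in $s$): $\mathit{usr}(s,t)$: add $t$ to $\mathit{rds},\mathit{pend}$; $\mathit{ovrl}(t):=(\mathit{wrts}(s)\neq\emptyset)$; $\mathit{posv}(t):=\{\mathit{stor}(s)\}\cup\{\mathit{rec}(s,t'):t'\in\mathit{wrts}(s)\}$. $\mathit{ufr}(s,t)$: remove $t$ from $\mathit{rds}$. $\mathit{usw}(s,t,d)$: add $t$ to $\mathit{wrts},\mathit{pend}$; $\mathit{rec}(t):=d$; $\mathit{ovrl}(t):=(\mathit{wrts}(s)\neq\emptyset)$; for all $t'\neq t$: $\mathit{ovrl}(t'):=\mathit{true}$,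 $\mathit{posv}(t'):=\mathit{posv}(s,t')\cup\{d\}$. $\mathit{ufw}(s,t,d)$: $\mathit{stor}:=d$, remove $t$ from $\mathit{wrts}$. $\mathit{uor}(s,t)$: remove $t$ from $\mathit{pend}$, $\mathit{rec}(t):=\mathit{stor}(s)$. $\mathit{uow}(s,t,d)$: $\mathit{stor}:=d$, remove $t$ from $\mathit{pend}$. In each register LTS, for all $s,t,d$: if $t\notin\mathit{rds}(s)\cup\mathit{wrts}(s)$, transitions $s\xrightarrow{\mathit{sr}_{t,r}}\mathit{usr}(s,t)$ and $s\xrightarrow{\mathit{sw}_{t,r}(d)}\mathit{usw}(s,t,d)$; and further: Safe: $t\in\mathit{rds}(s)$, $\neg\mathit{ovrl}(s,t)$: $\mathit{fr}_{t,r}(\mathit{stor}(s))$ to $\mathit{ufr}(s,t)$; $t\in\mathit{rds}(s)$, $\mathit{ovrl}(s,t)$: $\mathit{fr}_{t,r}(d)$ to $\mathit{ufr}(s,t)$; $t\in\mathit{wrts}(s)$, $\neg\mathit{ovrl}(s,t)$: $\mathit{fw}_{t,r}$ to $\mathit{ufw}(s,t,\mathit{rec}(s,t))$; $t\in\mathit{wrts}(s)$, $\mathit{ovrl}(s,t)$: $\mathit{fw}_{t,r}$ to $\mathit{ufw}(s,t,d)$. Regular: $t\in\mathit{rds}(s)$, $d\in\mathit{posv}(s,t)$: $\mathit{fr}_{t,r}(d)$ to $\mathit{ufr}(s,t)$; $t\in\mathit{wrts}(s)\cap\mathit{pend}(s)$: $\mathit{ow}_{t,r}$ to $\mathit{uow}(s,t,\mathit{rec}(s,t))$;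 $t\in\mathit{wrts}(s)\setminus\mathit{pend}(s)$: $\mathit{fw}_{t,r}$ to $\mathit{ufw}(s,t,\mathit{stor}(s))$. Atomic: $t\in\mathit{rds}(s)\cap\mathit{pend}(s)$: $\mathit{or}_{t,r}$ to $\mathit{uor}(s,t)$; $t\in\mathit{wrts}(s)\cap\mathit{pend}(s)$: $\mathit{ow}_{t,r}$ to $\mathit{uow}(s,t,\mathit{rec}(s,t))$; $t\in\mathit{rds}(s)\setminus\mathit{pend}(s)$: $\mathit{fr}_{t,r}(\mathit{rec}(s,t))$ to $\mathit{ufr}(s,t)$; $t\in\mathit{wrts}(s)\setminus\mathit{pend}(s)$: $\mathit{fw}_{t,r}$ to $\mathit{ufw}(s,t,\mathit{stor}(s))$. Threads. Each $t\in\mathbb T$ has a thread LTS $T_t$ with actions $\{\mathit{sr}_{t,r},\mathit{fr}_{t,r}(d),\mathit{sw}_{t,r}(d),\mathit{fw}_{t,r}:r\in\mathbb R,d\in D_r\}\cup\mathit{TLoc}_t$, the thread-local sets $\mathit{TLoc}_t$ pairwise disjoint and disjoint from register actions; on every path from its initial state, each $\mathit{sr}_{t,r}$-transition leads to a state where exactly the $\mathit{fr}_{t,r}(d)$, $d\in D_r$, are enabled, each $\mathit{sw}_{t,r}(d)$-transition leads to a state where only $\mathit{fw}_{t,r}$ is enabled, and $\mathit{fr}_{t,r}(d)$, $\mathit{fw}_{t,r}$ are enabled only in such states. A thread-register model is the parallel composition of all $T_t$ and one safe, regular or atomic register LTS per $r\in\mathbb R$, with $\mathit{thr}(a)=t$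 for every action indexed by $t$ (thread-local actions of $\mathit{TLoc}_t$ included) and $\mathit{reg}(a)=r$ for register actions of $r$, $\mathit{reg}(a)=\bot$ for thread-local actions. -}

module Defs where

open import Level using (Level; suc; _⊔_) renaming (zero to 0ℓ)
open import Data.Nat using (ℕ)
open import Data.Bool using (Bool; true; false; if_then_else_; _∨_)
open import Data.Fin using (Fin)
open import Data.Fin.Properties using (any?) renaming (_≟_ to _≟ᶠ_)
open import Data.Fin.Subset using (Subset; _∈_; _∉_; _∪_; ⁅_⁆)
open import Data.Fin.Subset.Properties using (nonempty?)
open import Data.Vec using (Vec; lookup; tabulate; replicate; _[_]≔_)
open import Data.Maybe using (Maybe; just; nothing)
open import Data.Product using (Σ; ∃; _×_; _,_)
open import Data.Sum using (_⊎_; inj₁; inj₂)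
open import Relation.Nullary using (¬_; does; yes; no)
open import Relation.Nullary.Decidable using (_×-dec_)
open import Data.Bool.Properties using () renaming (_≟_ to _≟ᵇ_)
open import Data.Unit using (⊤)
open import Relation.Binary.PropositionalEquality using (_≡_; _≢_; refl)
open import Function.Bundles using (_↔_; _⇔_)

record LTS (Act : Set) : Set₁ where
  field
    State : Set
    init  : State
    Trans : State → Act → State → Set

Finite : Set → Set
Finite A = Σ ℕ λ n → A ↔ Fin n

module _ {Act : Set} (L : LTS Act) where
  open LTS L

  Enabled : State → Act → Set
  Enabled s a = ∃ λ s' → Trans s a s'

  data PathAll (P : Act → Set) : State → State → Set where
    []  : ∀ {s} → PathAll P s s
    _∷_ : ∀ {s a s₁ s₂} → P a × Trans s a s₁ → PathAll P s₁ s₂ → PathAll P s s₂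

  Path : State → State → Set
  Path = PathAll (λ _ → ⊤)

  Reachable : State → Set
  Reachable s = Path init s

IsConcurrencyRelation : {Act : Set} → LTS Act → (Act → Act → Set) → Set
IsConcurrencyRelation {Act} L _⌣_ =
  (∀ a → ¬ (a ⌣ a)) ×
  (∀ (a : Act) (s s' : LTS.State L) → Enabled L s a →
     PathAll L (λ b → a ⌣ b) s s' → Enabled L s' a)

ReachablePart : {Act : Set} → LTS Act → LTS Act
ReachablePart L = record
  { State = Σ (LTS.State L) (Reachable L)
  ; init  = LTS.init L , []
  ; Trans = λ { (s , _) a (s' , _) → LTS.Trans L s a s' }
  }

-- Parallel composition of a family of LTSs indexed by I, whose action
-- sets are embedded into a common action type A; proj i a = just x iff
-- a is the action x of component i, and nothing iff a ∉ Act_i.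
Parallel : (I A : Set) (Aᵢ : I → Set) (L : (i : I) → LTS (Aᵢ i))
           (proj : (i : I) → A → Maybe (Aᵢ i)) → LTS A
Parallel I A Aᵢ L proj = record
  { State = (i : I) → LTS.State (L i)
  ; init  = λ i → LTS.init (L i)
  ; Trans = λ s a s' → ∀ i → Step i (proj i a) (s i) (s' i)
  }
  where
  Step : (i : I) → Maybe (Aᵢ i) → LTS.State (L i) → LTS.State (L i) → Set
  Step i nothing  x x' = x' ≡ x
  Step i (just b) x x' = LTS.Trans (L i) x b x'

record Params : Set where
  field
    nT   : ℕ
    nR   : ℕ
    D    : Fin nR → ℕ              -- domain D_r = Fin (D r)
    d0   : (r : Fin nR) → Fin (D r)
    nLoc : Fin nT → ℕ              -- thread-local actions TLoc_t = Fin (nLoc t)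

data RegKind : Set where
  safe regular atomic : RegKind

module _ (P : Params) where
  open Params P

  Thread : Set
  Thread = Fin nT

  Reg : Set
  Reg = Fin nR

  data Action : Set where
    sr  : Thread → (r : Reg) → Action
    fr  : Thread → (r : Reg) → Fin (D r) → Action
    sw  : Thread → (r : Reg) → Fin (D r) → Action
    fw  : Thread → (r : Reg) → Action
    or  : Thread → (r : Reg) → Action
    ow  : Thread → (r : Reg) → Action
    loc : (t : Thread) → Fin (nLoc t) → Action

  thr : Action → Thread
  thr (sr t _)   = t
  thr (fr t _ _) = t
  thr (sw t _ _) = t
  thr (fw t _)   = t
  thr (or t _)   = t
  thr (ow t _)   = t
  thr (loc t _)  = t

  _⌣T_ : Action → Action → Set
  a ⌣T b = thr a ≢ thr b

  data TAct (t : Thread) : Set where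
    tsr  : (r : Reg) → TAct t
    tfr  : (r : Reg) → Fin (D r) → TAct t
    tsw  : (r : Reg) → Fin (D r) → TAct t
    tfw  : (r : Reg) → TAct t
    tloc : Fin (nLoc t) → TAct t

  data RAct (r : Reg) : Set where
    rsr : Thread → RAct r
    rfr : Thread → Fin (D r) → RAct r
    rsw : Thread → Fin (D r) → RAct r
    rfw : Thread → RAct r
    ror : Thread → RAct r
    row : Thread → RAct r

  projT : (t : Thread) → Action → Maybe (TAct t)
  projT t (sr t' r) with t' ≟ᶠ t
  ... | yes _ = just (tsr r)
  ... | no  _ = nothing
  projT t (fr t' r d) with t' ≟ᶠ t
  ... | yes _ = just (tfr r d)
  ... | no  _ = nothing
  projT t (sw t' r d) with t' ≟ᶠ t
  ... | yes _ = just (tsw r d)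
  ... | no  _ = nothing
  projT t (fw t' r) with t' ≟ᶠ t
  ... | yes _ = just (tfw r)
  ... | no  _ = nothing
  projT t (or _ _) = nothing
  projT t (ow _ _) = nothing
  projT t (loc t' l) with t' ≟ᶠ t
  ... | yes refl = just (tloc l)
  ... | no  _    = nothing

  projR : (r : Reg) → Action → Maybe (RAct r)
  projR r (sr t r') with r' ≟ᶠ r
  ... | yes _ = just (rsr t)
  ... | no  _ = nothing
  projR r (fr t r' d) with r' ≟ᶠ r
  ... | yes refl = just (rfr t d)
  ... | no  _    = nothing
  projR r (sw t r' d) with r' ≟ᶠ r
  ... | yes refl = just (rsw t d)
  ... | no  _    = nothing
  projR r (fw t r') with r' ≟ᶠ r
  ... | yes _ = just (rfw t)
  ... | no  _ = nothing
  projR r (or t r') with r' ≟ᶠ r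
  ... | yes _ = just (ror t)
  ... | no  _ = nothing
  projR r (ow t r') with r' ≟ᶠ r
  ... | yes _ = just (row t)
  ... | no  _ = nothing
  projR r (loc _ _) = nothing

  record Status (r : Reg) : Set where
    constructor status
    field
      stor : Fin (D r)
      rds  : Subset nT
      wrts : Subset nT
      pend : Subset nT
      rec  : Vec (Fin (D r)) nT
      ovrl : Vec Bool nT
      posv : Vec (Subset (D r)) nT

  initStatus : (r : Reg) → Status r
  initStatus r = status (d0 r) (replicate nT false) (replicate nT false)
    (replicate nT false) (replicate nT (d0 r)) (replicate nT false)
    (replicate nT (replicate (D r) false))

  module _ {r : Reg} where
    open Status

    nonemptyB : Subset nT → Bool
    nonemptyB w = does (nonempty? w)

    -- { rec(s,t') : t' ∈ wrts(s) }
    recOfWriters : Status r → Subset (D r)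
    recOfWriters s = tabulate λ d →
      does (any? (λ t' → (lookup (wrts s) t' ≟ᵇ true) ×-dec (lookup (rec s) t' ≟ᶠ d)))

    usr : Status r → Thread → Status r
    usr s t = record s
      { rds  = rds s [ t ]≔ true
      ; pend = pend s [ t ]≔ true
      ; ovrl = ovrl s [ t ]≔ nonemptyB (wrts s)
      ; posv = posv s [ t ]≔ (⁅ stor s ⁆ ∪ recOfWriters s)
      }

    ufr : Status r → Thread → Status r
    ufr s t = record s { rds = rds s [ t ]≔ false }

    usw : Status r → Thread → Fin (D r) → Status r
    usw s t d = record s
      { wrts = wrts s [ t ]≔ true
      ; pend = pend s [ t ]≔ true
      ; rec  = rec s [ t ]≔ d
      ; ovrl = tabulate λ t' →
                 if does (t' ≟ᶠ t) then nonemptyB (wrts s) else true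
      ; posv = tabulate λ t' →
                 if does (t' ≟ᶠ t) then lookup (posv s) t'
                 else (lookup (posv s) t' ∪ ⁅ d ⁆)
      }

    ufw : Status r → Thread → Fin (D r) → Status r
    ufw s t d = record s { stor = d ; wrts = wrts s [ t ]≔ false }

    uor : Status r → Thread → Status r
    uor s t = record s { pend = pend s [ t ]≔ false ; rec = rec s [ t ]≔ stor s }

    uow : Status r → Thread → Fin (D r) → Status r
    uow s t d = record s { stor = d ; pend = pend s [ t ]≔ false }

  open Status

  data RStep (r : Reg) : RegKind → Status r → RAct r → Status r → Set where
    start-read  : ∀ {k s t} → t ∉ rds s → t ∉ wrts s →
                  RStep r k s (rsr t) (usr s t)
    start-write : ∀ {k s t d} → t ∉ rds s → t ∉ wrts s →
                  RStep r k s (rsw t d) (usw s t d)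
    safe-fr     : ∀ {s t} → t ∈ rds s → lookup (ovrl s) t ≡ false →
                  RStep r safe s (rfr t (stor s)) (ufr s t)
    safe-fr-ov  : ∀ {s t d} → t ∈ rds s → lookup (ovrl s) t ≡ true →
                  RStep r safe s (rfr t d) (ufr s t)
    safe-fw     : ∀ {s t} → t ∈ wrts s → lookup (ovrl s) t ≡ false →
                  RStep r safe s (rfw t) (ufw s t (lookup (rec s) t))
    safe-fw-ov  : ∀ {s t d} → t ∈ wrts s → lookup (ovrl s) t ≡ true →
                  RStep r safe s (rfw t) (ufw s t d)
    reg-fr      : ∀ {s t d} → t ∈ rds s → d ∈ lookup (posv s) t →
                  RStep r regular s (rfr t d) (ufr s t)
    reg-ow      : ∀ {s t} → t ∈ wrts s → t ∈ pend s →
                  RStep r regular s (row t) (uow s t (lookup (rec s) t))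
    reg-fw      : ∀ {s t} → t ∈ wrts s → t ∉ pend s →
                  RStep r regular s (rfw t) (ufw s t (stor s))
    at-or       : ∀ {s t} → t ∈ rds s → t ∈ pend s →
                  RStep r atomic s (ror t) (uor s t)
    at-ow       : ∀ {s t} → t ∈ wrts s → t ∈ pend s →
                  RStep r atomic s (row t) (uow s t (lookup (rec s) t))
    at-fr       : ∀ {s t} → t ∈ rds s → t ∉ pend s →
                  RStep r atomic s (rfr t (lookup (rec s) t)) (ufr s t)
    at-fw       : ∀ {s t} → t ∈ wrts s → t ∉ pend s →
                  RStep r atomic s (rfw t) (ufw s t (stor s))

  RegisterLTS : RegKind → (r : Reg) → LTS (RAct r)
  RegisterLTS k r = record
    { State = Status r ; init = initStatus r ; Trans = RStep r k }

  record IsThreadLTS (t : Thread) (T : LTS (TAct t)) : Set where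
    open LTS T
    field
      finite : Finite State
      after-sr : ∀ {s₀ s r} → Reachable T s₀ → Trans s₀ (tsr r) s →
                 ∀ x → Enabled T s x ⇔ (∃ λ d → x ≡ tfr r d)
      after-sw : ∀ {s₀ s r d} → Reachable T s₀ → Trans s₀ (tsw r d) s →
                 ∀ x → Enabled T s x ⇔ (x ≡ tfw r)
      fr-init  : ∀ {r d} → ¬ Enabled T init (tfr r d)
      fr-only  : ∀ {s₀ x s r d} → Reachable T s₀ → Trans s₀ x s →
                 Enabled T s (tfr r d) → x ≡ tsr r
      fw-init  : ∀ {r} → ¬ Enabled T init (tfw r)
      fw-only  : ∀ {s₀ x s r} → Reachable T s₀ → Trans s₀ x s →
                 Enabled T s (tfw r) → ∃ λ d → x ≡ tsw r d

  CompAct : Thread ⊎ Reg → Set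
  CompAct (inj₁ t) = TAct t
  CompAct (inj₂ r) = RAct r

  TRModel : (kind : Reg → RegKind) (T : (t : Thread) → LTS (TAct t)) → LTS Action
  TRModel kind T = Parallel (Thread ⊎ Reg) Action CompAct comp proj
    where
    comp : (i : Thread ⊎ Reg) → LTS (CompAct i)
    comp (inj₁ t) = T t
    comp (inj₂ r) = RegisterLTS (kind r) r
    proj : (i : Thread ⊎ Reg) → Action → Maybe (CompAct i)
    proj (inj₁ t) = projT t
    proj (inj₂ r) = projR r

-- A step of thread t₀ touches only its own entries of a register status,
-- except that it may set the overlap flags and enlarge the sets of possible
-- values of other threads; so an enabled step of another thread stays
-- enabled.  The one exception is a non-overlapped safe read, which must
-- return the stored value: it is protected by the invariant that a reader
-- concurrent with a writer of another thread is always flagged overlapped.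
-- Thread components are untouched by the actions of other threads, and a
-- parallel composition inherits both facts componentwise.
module Submission where

open import Defs
open import Data.Bool using (true; false; if_then_else_)
open import Data.Fin using (Fin)
open import Data.Fin.Properties using () renaming (_≟_ to _≟ᶠ_)
open import Data.Fin.Subset using (Subset; _∈_; _∉_; _⊆_; ⁅_⁆; _∪_)
open import Data.Fin.Subset.Properties using (nonempty?; p⊆p∪q; ⊆-reflexive; ⊆-trans)
open import Data.Maybe using (Maybe; just; nothing)
open import Data.Product using (∃; _×_; _,_; proj₁; proj₂)
open import Data.Sum using (_⊎_; inj₁; inj₂)
open import Data.Unit using (tt)
open import Data.Vec using (lookup; tabulate; _[_]≔_)
open import Data.Vec.Properties
  using (lookup∘update; lookup∘update′; lookup∘tabulate; lookup-replicate; []=⇒lookup; lookup⇒[]=)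
open import Relation.Nullary using (¬_; does; yes; no; contradiction)
open import Relation.Nullary.Decidable using (dec-true; dec-false)
open import Relation.Binary.PropositionalEquality using (_≡_; _≢_; refl; sym; trans; cong)

module _ {Act : Set} (L : LTS Act) where
  open LTS L

  Trans? : Maybe Act → State → State → Set
  Trans? nothing  s s' = s' ≡ s
  Trans? (just a) s s' = Trans s a s'

  Trans?-preserves : (Inv : State → Set) → (∀ {s a s'} → Trans s a s' → Inv s → Inv s') →
                     ∀ {m s s'} → Trans? m s s' → Inv s → Inv s'
  Trans?-preserves Inv pres {nothing} refl inv = inv
  Trans?-preserves Inv pres {just a}  tr   inv = pres tr inv

  Trans?-persists : ∀ {ma mb s s' s₁} →
                    (∀ {a b} → ma ≡ just a → mb ≡ just b → Trans s a s' → Trans s b s₁ → Enabled L s₁ a) →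
                    Trans? ma s s' → Trans? mb s s₁ → ∃ (Trans? ma s₁)
  Trans?-persists {nothing}          _ _   _    = _ , refl
  Trans?-persists {just a} {nothing} _ tra refl = _ , tra
  Trans?-persists {just a} {just b}  h tra trb  = h refl refl tra trb

  PathAll-preserves : ∀ {Q} (Inv : State → Set) → (∀ {s a s'} → Trans s a s' → Inv s → Inv s') →
                      ∀ {s s'} → PathAll L Q s s' → Inv s → Inv s'
  PathAll-preserves Inv pres []              inv = inv
  PathAll-preserves Inv pres ((_ , tr) ∷ p) inv = PathAll-preserves Inv pres p (pres tr inv)

  _∷ʳ_ : ∀ {Q s s₁ a s₂} → PathAll L Q s s₁ → Q a × Trans s₁ a s₂ → PathAll L Q s s₂
  []      ∷ʳ step = step ∷ []
  (h ∷ p) ∷ʳ step = h ∷ (p ∷ʳ step)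

  reachablePart-concurrency :
    (_⌣_ : Act → Act → Set) → (∀ a → ¬ a ⌣ a) →
    (∀ {s a b s₁} → Reachable L s → a ⌣ b → Enabled L s a → Trans s b s₁ → Enabled L s₁ a) →
    IsConcurrencyRelation (ReachablePart L) _⌣_
  reachablePart-concurrency _⌣_ irrefl persists = irrefl , λ a _ _ en p → along p en
    where
    RP = ReachablePart L

    step : ∀ {a b x x₁} → a ⌣ b → Enabled RP x a → LTS.Trans RP x b x₁ → Enabled RP x₁ a
    step {x = s , rs} {x₁ = s₁ , rs₁} a⌣b (_ , tra) trb with persists rs a⌣b (_ , tra) trb
    ... | s₂ , tra' = (s₂ , rs₁ ∷ʳ (tt , tra')) , tra'

    along : ∀ {a x y} → PathAll RP (a ⌣_) x y → Enabled RP x a → Enabled RP y a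
    along []               en = en
    along (_∷_ {s = x} {b} {x₁} (a⌣b , tr) p) en = along p (step {b = b} {x} {x₁} a⌣b en tr)

∈-resp : ∀ {n} {p q : Subset n} {i} → lookup p i ≡ lookup q i → i ∈ p → i ∈ q
∈-resp {q = q} {i} e i∈p = lookup⇒[]= i q (trans (sym e) ([]=⇒lookup i∈p))

∉-resp : ∀ {n} {p q : Subset n} {i} → lookup p i ≡ lookup q i → i ∉ p → i ∉ q
∉-resp e i∉p i∈q = i∉p (∈-resp (sym e) i∈q)

∈-[]≔false⁻ : ∀ {n} (p : Subset n) {i j} → j ∈ (p [ i ]≔ false) → j ∈ p
∈-[]≔false⁻ p {i} {j} j∈p' with j ≟ᶠ i
... | yes refl with () ← trans (sym (lookup∘update i p false)) ([]=⇒lookup j∈p')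
... | no j≢i = ∈-resp (lookup∘update′ j≢i p false) j∈p'

module _ {P : Params} where
  open Params P
  open Status

  private variable
    r : Reg P
    k : RegKind
    t t₀ : Thread P
    x x₁ y : Status P r
    a b : RAct P r

  thrR : RAct P r → Thread P
  thrR (rsr t)   = t
  thrR (rfr t _) = t
  thrR (rsw t _) = t
  thrR (rfw t)   = t
  thrR (ror t)   = t
  thrR (row t)   = t

  lookup-tabulate-else : {A : Set} (f g : Thread P → A) → t ≢ t₀ →
    lookup (tabulate λ t' → if does (t' ≟ᶠ t₀) then f t' else g t') t ≡ g t
  lookup-tabulate-else {t = t} {t₀} f g t≢t₀ =
    trans (lookup∘tabulate _ t) (cong (if_then f t else g t) (dec-false (t ≟ᶠ t₀) t≢t₀))

  record Undisturbed (t : Thread P) (x x₁ : Status P r) : Set where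
    field
      rds-≡   : lookup (rds x) t ≡ lookup (rds x₁) t
      wrts-≡  : lookup (wrts x) t ≡ lookup (wrts x₁) t
      pend-≡  : lookup (pend x) t ≡ lookup (pend x₁) t
      rec-≡   : lookup (rec x) t ≡ lookup (rec x₁) t
      ovrl-⇒  : lookup (ovrl x) t ≡ true → lookup (ovrl x₁) t ≡ true
      posv-⊆  : lookup (posv x) t ⊆ lookup (posv x₁) t
  open Undisturbed

  usr-undisturbed : (x : Status P r) → t ≢ t₀ → Undisturbed t x (usr P x t₀)
  usr-undisturbed x t≢t₀ = record
    { rds-≡  = sym (lookup∘update′ t≢t₀ (rds x) true)
    ; wrts-≡ = refl
    ; pend-≡ = sym (lookup∘update′ t≢t₀ (pend x) true)
    ; rec-≡  = refl
    ; ovrl-⇒ = trans (lookup∘update′ t≢t₀ (ovrl x) _)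
    ; posv-⊆ = ⊆-reflexive (sym (lookup∘update′ t≢t₀ (posv x) _))
    }

  usw-undisturbed : (x : Status P r) (d : Fin (D r)) → t ≢ t₀ → Undisturbed t x (usw P x t₀ d)
  usw-undisturbed x d t≢t₀ = record
    { rds-≡  = refl
    ; wrts-≡ = sym (lookup∘update′ t≢t₀ (wrts x) true)
    ; pend-≡ = sym (lookup∘update′ t≢t₀ (pend x) true)
    ; rec-≡  = sym (lookup∘update′ t≢t₀ (rec x) d)
    ; ovrl-⇒ = λ _ → lookup-tabulate-else _ (λ _ → true) t≢t₀
    ; posv-⊆ = ⊆-trans (p⊆p∪q ⁅ d ⁆)
                 (⊆-reflexive (sym (lookup-tabulate-else _ (λ t' → lookup (posv x) t' ∪ ⁅ d ⁆) t≢t₀)))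
    }

  ufr-undisturbed : (x : Status P r) → t ≢ t₀ → Undisturbed t x (ufr P x t₀)
  ufr-undisturbed x t≢t₀ = record
    { rds-≡  = sym (lookup∘update′ t≢t₀ (rds x) false)
    ; wrts-≡ = refl ; pend-≡ = refl ; rec-≡ = refl ; ovrl-⇒ = λ h → h ; posv-⊆ = λ m → m
    }

  ufw-undisturbed : (x : Status P r) (d : Fin (D r)) → t ≢ t₀ → Undisturbed t x (ufw P x t₀ d)
  ufw-undisturbed x d t≢t₀ = record
    { wrts-≡ = sym (lookup∘update′ t≢t₀ (wrts x) false)
    ; rds-≡  = refl ; pend-≡ = refl ; rec-≡ = refl ; ovrl-⇒ = λ h → h ; posv-⊆ = λ m → m
    }

  uor-undisturbed : (x : Status P r) → t ≢ t₀ → Undisturbed t x (uor P x t₀)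
  uor-undisturbed x t≢t₀ = record
    { pend-≡ = sym (lookup∘update′ t≢t₀ (pend x) false)
    ; rec-≡  = sym (lookup∘update′ t≢t₀ (rec x) _)
    ; rds-≡  = refl ; wrts-≡ = refl ; ovrl-⇒ = λ h → h ; posv-⊆ = λ m → m
    }

  uow-undisturbed : (x : Status P r) (d : Fin (D r)) → t ≢ t₀ → Undisturbed t x (uow P x t₀ d)
  uow-undisturbed x d t≢t₀ = record
    { pend-≡ = sym (lookup∘update′ t≢t₀ (pend x) false)
    ; rds-≡  = refl ; wrts-≡ = refl ; rec-≡ = refl ; ovrl-⇒ = λ h → h ; posv-⊆ = λ m → m
    }

  step-undisturbed : RStep P r k x b x₁ → t ≢ thrR b → Undisturbed t x x₁
  step-undisturbed (start-read  {s = x} _ _)          = usr-undisturbed x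
  step-undisturbed (start-write {s = x} {d = d} _ _)  = usw-undisturbed x d
  step-undisturbed (safe-fr     {s = x} _ _)          = ufr-undisturbed x
  step-undisturbed (safe-fr-ov  {s = x} _ _)          = ufr-undisturbed x
  step-undisturbed (safe-fw     {s = x} _ _)          = ufw-undisturbed x _
  step-undisturbed (safe-fw-ov  {s = x} _ _)          = ufw-undisturbed x _
  step-undisturbed (reg-fr      {s = x} _ _)          = ufr-undisturbed x
  step-undisturbed (reg-ow      {s = x} _ _)          = uow-undisturbed x _
  step-undisturbed (reg-fw      {s = x} _ _)          = ufw-undisturbed x _
  step-undisturbed (at-or       {s = x} _ _)          = uor-undisturbed x
  step-undisturbed (at-ow       {s = x} _ _)          = uow-undisturbed x _
  step-undisturbed (at-fr       {s = x} _ _)          = ufr-undisturbed x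
  step-undisturbed (at-fw       {s = x} _ _)          = ufw-undisturbed x _

  OverlapFlagged : Status P r → Set
  OverlapFlagged x = ∀ {t t'} → t ∈ rds x → t' ∈ wrts x → t ≢ t' → lookup (ovrl x) t ≡ true

  initStatus-overlapFlagged : (r : Reg P) → OverlapFlagged (initStatus P r)
  initStatus-overlapFlagged r {t} t∈rds
    with () ← trans (sym (lookup-replicate t false)) ([]=⇒lookup t∈rds)

  step-overlapFlagged : RStep P r k x b x₁ → OverlapFlagged x → OverlapFlagged x₁
  step-overlapFlagged (start-read {s = x} {t = t₀} _ _) flagged {t} {t'} t∈rds t'∈wrts t≢t'
    with t ≟ᶠ t₀
  ... | yes refl = trans (lookup∘update t (ovrl x) _) (dec-true (nonempty? (wrts x)) (t' , t'∈wrts))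
  ... | no t≢t₀  = trans (lookup∘update′ t≢t₀ (ovrl x) _)
                     (flagged (∈-resp (lookup∘update′ t≢t₀ (rds x) true) t∈rds) t'∈wrts t≢t')
  step-overlapFlagged (start-write {s = x} {t = t₀} t₀∉rds _) flagged {t} t∈rds _ _
    with t ≟ᶠ t₀
  ... | yes refl = contradiction t∈rds t₀∉rds
  ... | no t≢t₀  = lookup-tabulate-else _ (λ _ → true) t≢t₀
  step-overlapFlagged (safe-fr    {s = x} _ _) flagged t∈rds = flagged (∈-[]≔false⁻ (rds x) t∈rds)
  step-overlapFlagged (safe-fr-ov {s = x} _ _) flagged t∈rds = flagged (∈-[]≔false⁻ (rds x) t∈rds)
  step-overlapFlagged (reg-fr     {s = x} _ _) flagged t∈rds = flagged (∈-[]≔false⁻ (rds x) t∈rds)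
  step-overlapFlagged (at-fr      {s = x} _ _) flagged t∈rds = flagged (∈-[]≔false⁻ (rds x) t∈rds)
  step-overlapFlagged (safe-fw    {s = x} _ _) flagged t∈rds w = flagged t∈rds (∈-[]≔false⁻ (wrts x) w)
  step-overlapFlagged (safe-fw-ov {s = x} _ _) flagged t∈rds w = flagged t∈rds (∈-[]≔false⁻ (wrts x) w)
  step-overlapFlagged (reg-fw     {s = x} _ _) flagged t∈rds w = flagged t∈rds (∈-[]≔false⁻ (wrts x) w)
  step-overlapFlagged (at-fw      {s = x} _ _) flagged t∈rds w = flagged t∈rds (∈-[]≔false⁻ (wrts x) w)
  step-overlapFlagged (reg-ow _ _) flagged = flagged
  step-overlapFlagged (at-or  _ _) flagged = flagged
  step-overlapFlagged (at-ow  _ _) flagged = flagged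

  stor-unchanged-or-writer : RStep P r k x b x₁ → stor x₁ ≡ stor x ⊎ thrR b ∈ wrts x
  stor-unchanged-or-writer (start-read _ _)  = inj₁ refl
  stor-unchanged-or-writer (start-write _ _) = inj₁ refl
  stor-unchanged-or-writer (safe-fr _ _)     = inj₁ refl
  stor-unchanged-or-writer (safe-fr-ov _ _)  = inj₁ refl
  stor-unchanged-or-writer (reg-fr _ _)      = inj₁ refl
  stor-unchanged-or-writer (at-or _ _)       = inj₁ refl
  stor-unchanged-or-writer (at-fr _ _)       = inj₁ refl
  stor-unchanged-or-writer (safe-fw w _)     = inj₂ w
  stor-unchanged-or-writer (safe-fw-ov w _)  = inj₂ w
  stor-unchanged-or-writer (reg-ow w _)      = inj₂ w
  stor-unchanged-or-writer (reg-fw w _)      = inj₂ w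
  stor-unchanged-or-writer (at-ow w _)       = inj₂ w
  stor-unchanged-or-writer (at-fw w _)       = inj₂ w

  stor-stable : OverlapFlagged x → RStep P r k x b x₁ → t ≢ thrR b →
                t ∈ rds x → lookup (ovrl x) t ≡ false → stor x₁ ≡ stor x
  stor-stable flagged trb t≢t₀ t∈rds off with stor-unchanged-or-writer trb
  ... | inj₁ unchanged = unchanged
  ... | inj₂ writer with () ← trans (sym off) (flagged t∈rds writer t≢t₀)

  undisturbed-enabled : Undisturbed (thrR a) x x₁ →
                        (thrR a ∈ rds x → lookup (ovrl x) (thrR a) ≡ false → stor x₁ ≡ stor x) →
                        RStep P r k x a y → ∃ (RStep P r k x₁ a)
  undisturbed-enabled {x₁ = x₁} U stor-ok (safe-fr {t = t} m off) with lookup (ovrl x₁) t in ov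
  ... | true  = _ , safe-fr-ov (∈-resp (rds-≡ U) m) ov
  ... | false rewrite sym (stor-ok m off) = _ , safe-fr (∈-resp (rds-≡ U) m) ov
  undisturbed-enabled {x₁ = x₁} U _ (safe-fw {t = t} m _) with lookup (ovrl x₁) t in ov
  ... | true  = _ , safe-fw-ov {d = stor x₁} (∈-resp (wrts-≡ U) m) ov
  ... | false = _ , safe-fw (∈-resp (wrts-≡ U) m) ov
  undisturbed-enabled U _ (start-read  n n') = _ , start-read  (∉-resp (rds-≡ U) n) (∉-resp (wrts-≡ U) n')
  undisturbed-enabled U _ (start-write n n') = _ , start-write (∉-resp (rds-≡ U) n) (∉-resp (wrts-≡ U) n')
  undisturbed-enabled U _ (safe-fr-ov m ov)  = _ , safe-fr-ov (∈-resp (rds-≡ U) m) (ovrl-⇒ U ov)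
  undisturbed-enabled U _ (safe-fw-ov {d = d} m ov) =
    _ , safe-fw-ov {d = d} (∈-resp (wrts-≡ U) m) (ovrl-⇒ U ov)
  undisturbed-enabled U _ (reg-fr m pd)      = _ , reg-fr (∈-resp (rds-≡ U) m) (posv-⊆ U pd)
  undisturbed-enabled U _ (reg-ow m p)       = _ , reg-ow (∈-resp (wrts-≡ U) m) (∈-resp (pend-≡ U) p)
  undisturbed-enabled U _ (reg-fw m np)      = _ , reg-fw (∈-resp (wrts-≡ U) m) (∉-resp (pend-≡ U) np)
  undisturbed-enabled U _ (at-or m p)        = _ , at-or (∈-resp (rds-≡ U) m) (∈-resp (pend-≡ U) p)
  undisturbed-enabled U _ (at-ow m p)        = _ , at-ow (∈-resp (wrts-≡ U) m) (∈-resp (pend-≡ U) p)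
  undisturbed-enabled U _ (at-fw m np)       = _ , at-fw (∈-resp (wrts-≡ U) m) (∉-resp (pend-≡ U) np)
  undisturbed-enabled U _ (at-fr m np) rewrite rec-≡ U =
    _ , at-fr (∈-resp (rds-≡ U) m) (∉-resp (pend-≡ U) np)

  register-enabled-persists : OverlapFlagged x → thrR a ≢ thrR b →
                              RStep P r k x a y → RStep P r k x b x₁ → ∃ (RStep P r k x₁ a)
  register-enabled-persists flagged a≢b tra trb =
    undisturbed-enabled (step-undisturbed trb a≢b) (stor-stable flagged trb a≢b) tra

module _ (P : Params) where

  projT-thr : ∀ t a {c} → projT P t a ≡ just c → thr P a ≡ t
  projT-thr t (sr t' _) e with t' ≟ᶠ t
  ... | yes t'≡t = t'≡t
  ... | no _ with () ← e
  projT-thr t (fr t' _ _) e with t' ≟ᶠ t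
  ... | yes t'≡t = t'≡t
  ... | no _ with () ← e
  projT-thr t (sw t' _ _) e with t' ≟ᶠ t
  ... | yes t'≡t = t'≡t
  ... | no _ with () ← e
  projT-thr t (fw t' _) e with t' ≟ᶠ t
  ... | yes t'≡t = t'≡t
  ... | no _ with () ← e
  projT-thr t (loc t' _) e with t' ≟ᶠ t
  ... | yes t'≡t = t'≡t
  ... | no _ with () ← e
  projT-thr t (or _ _) ()
  projT-thr t (ow _ _) ()

  projR-thr : ∀ r a {c} → projR P r a ≡ just c → thrR c ≡ thr P a
  projR-thr r (sr _ r') e with r' ≟ᶠ r
  ... | yes _    with refl ← e = refl
  ... | no _     with () ← e
  projR-thr r (fr _ r' _) e with r' ≟ᶠ r
  ... | yes refl with refl ← e = refl
  ... | no _     with () ← e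
  projR-thr r (sw _ r' _) e with r' ≟ᶠ r
  ... | yes refl with refl ← e = refl
  ... | no _     with () ← e
  projR-thr r (fw _ r') e with r' ≟ᶠ r
  ... | yes _    with refl ← e = refl
  ... | no _     with () ← e
  projR-thr r (or _ r') e with r' ≟ᶠ r
  ... | yes _    with refl ← e = refl
  ... | no _     with () ← e
  projR-thr r (ow _ r') e with r' ≟ᶠ r
  ... | yes _    with refl ← e = refl
  ... | no _     with () ← e
  projR-thr r (loc _ _) ()

  module _ (kind : Reg P → RegKind) (T : (t : Thread P) → LTS (TAct P t)) where
    M : LTS (Action P)
    M = TRModel P kind T

    open LTS M using (State; Trans)

    Register : (r : Reg P) → LTS (RAct P r)
    Register r = RegisterLTS P (kind r) r

    -- TRModel's components are local to its definition, so transitions are split by hand.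
    trans⇒threadStep : ∀ {s a s'} → Trans s a s' →
                       ∀ t → Trans? (T t) (projT P t a) (s (inj₁ t)) (s' (inj₁ t))
    trans⇒threadStep {a = a} tr t with projT P t a | tr (inj₁ t)
    ... | nothing | step = step
    ... | just _  | step = step

    trans⇒registerStep : ∀ {s a s'} → Trans s a s' →
                         ∀ r → Trans? (Register r) (projR P r a) (s (inj₂ r)) (s' (inj₂ r))
    trans⇒registerStep {a = a} tr r with projR P r a | tr (inj₂ r)
    ... | nothing | step = step
    ... | just _  | step = step

    steps⇒trans : ∀ {s a s'} →
                  (∀ t → Trans? (T t) (projT P t a) (s (inj₁ t)) (s' (inj₁ t))) →
                  (∀ r → Trans? (Register r) (projR P r a) (s (inj₂ r)) (s' (inj₂ r))) →
                  Trans s a s'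
    steps⇒trans {a = a} threadSteps _ (inj₁ t) with projT P t a | threadSteps t
    ... | nothing | step = step
    ... | just _  | step = step
    steps⇒trans {a = a} _ registerSteps (inj₂ r) with projR P r a | registerSteps r
    ... | nothing | step = step
    ... | just _  | step = step

    RegistersFlagged : State → Set
    RegistersFlagged s = ∀ r → OverlapFlagged (s (inj₂ r))

    reachable-registersFlagged : ∀ {s} → Reachable M s → RegistersFlagged s
    reachable-registersFlagged rs =
      PathAll-preserves M RegistersFlagged preserves rs (initStatus-overlapFlagged {P})
      where
      preserves : ∀ {s a s'} → Trans s a s' → RegistersFlagged s → RegistersFlagged s'
      preserves {s} {a} {s'} tr flagged r =
        Trans?-preserves (Register r) OverlapFlagged step-overlapFlagged
          {projR P r a} {s (inj₂ r)} {s' (inj₂ r)} (trans⇒registerStep tr r) (flagged r)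

    enabled-persists : ∀ {s a b s₁} → Reachable M s → thr P a ≢ thr P b →
                       Enabled M s a → Trans s b s₁ → Enabled M s₁ a
    enabled-persists {s} {a} {b} {s₁} rs a≢b (_ , tra) trb =
      s₂ , steps⇒trans (λ t → proj₂ (thread t)) (λ r → proj₂ (register r))
      where
      thread : ∀ t → ∃ (Trans? (T t) (projT P t a) (s₁ (inj₁ t)))
      thread t = Trans?-persists (T t)
        (λ a↦ b↦ _ _ → contradiction (trans (projT-thr t a a↦) (sym (projT-thr t b b↦))) a≢b)
        (trans⇒threadStep tra t) (trans⇒threadStep trb t)
      register : ∀ r → ∃ (Trans? (Register r) (projR P r a) (s₁ (inj₂ r)))
      register r = Trans?-persists (Register r)
        (λ a↦ b↦ → register-enabled-persists {x = s (inj₂ r)} (reachable-registersFlagged rs r)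
                     (λ e → a≢b (trans (sym (projR-thr r a a↦)) (trans e (projR-thr r b b↦)))))
        (trans⇒registerStep tra r) (trans⇒registerStep trb r)

      s₂ : State
      s₂ (inj₁ t) = proj₁ (thread t)
      s₂ (inj₂ r) = proj₁ (register r)

lemma8 : (P : Params) (kind : Reg P → RegKind)
    (T : (t : Thread P) → LTS (TAct P t)) →
    ((t : Thread P) → IsThreadLTS P t (T t)) →
    IsConcurrencyRelation (ReachablePart (TRModel P kind T)) (_⌣T_ P)
lemma8 P kind T _ =
  reachablePart-concurrency (TRModel P kind T) (_⌣T_ P) (λ _ a≢a → a≢a refl) (enabled-persists P kind T)
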